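{- Let $R$ be an integral domain, let $S\subseteq R$ be infinite, and let $p_1,\dots,p_m\in R[x_1,\dots,x_n]$ be such that the system $p_i(x_1,\dots,x_n)=0$ ($1\le i\le m$) is partition regular over $S$ and has no constant solution $x_1=\dots=x_n=c\in S$. Then for any partition $S=C_1\cup\dots\cup C_\ell$ there exist $1\le i_0\le\ell$ and a sequence $(a_1(t),\dots,a_n(t))_{t\ge1}\subseteq C_{i_0}^n$ such that: (i) $p_i(a_1(t),\dots,a_n(t))=0$ for all $t\in\mathbb{N}$ and all $1\le i\le m$; (ii) for $t_1<t_2$ and any $i,j\in[1,n]$, $a_i(t_1)\neq a_j(t_2)$; (iii) if the system is injectively partition regular over $S$, then also $a_i(t)\neq a_j(t)$ for all $t$ and all $i\ne j$.
   Context: The system is ($\ell$-)partition regular over $S$ if for every partition $S=C_1\cup\dots\cup C_r$ (with $r\le \ell$, resp. for every finite $r$) some cell contains $a_1,\dots,a_n$ with $p_i(a_1,\dots,a_n)=0$ for all $i$; injectively partition regular if moreover $a_1,\dots,a_n$ can be taken pairwise distinct. -}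

module Defs where

open import Level using (Level; _⊔_)
open import Algebra.Bundles using (CommutativeRing)
open import Data.Nat using (ℕ; _<_)
open import Data.Fin using (Fin)
open import Data.List using (List)
open import Data.List.Membership.Setoid using ()
open import Data.List.Relation.Unary.Any using (Any)
open import Data.Product using (Σ; ∃; _×_)
open import Data.Sum using (_⊎_)
open import Relation.Nullary using (¬_)
open import Relation.Unary using (Pred; _∈_)
open import Relation.Binary.PropositionalEquality using (_≡_; _≢_)

record IsIntegralDomain {c ℓ} (R : CommutativeRing c ℓ) : Set (c ⊔ ℓ) where
  open CommutativeRing R
  field
    1≉0        : ¬ (1# ≈ 0#)
    noZeroDiv  : ∀ x y → x * y ≈ 0# → (x ≈ 0#) ⊎ (y ≈ 0#)

module _ {c ℓ} (R : CommutativeRing c ℓ) where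
  open CommutativeRing R

  -- Polynomials in R[x₁,…,xₙ], represented as polynomial expressions
  -- (only their evaluation matters for the statement).
  data Poly (n : ℕ) : Set c where
    con  : Carrier → Poly n
    var  : Fin n → Poly n
    _⊕_  : Poly n → Poly n → Poly n
    _⊗_  : Poly n → Poly n → Poly n
    ⊝_   : Poly n → Poly n

  eval : ∀ {n} → Poly n → (Fin n → Carrier) → Carrier
  eval (con r)  a = r
  eval (var i)  a = a i
  eval (p ⊕ q)  a = eval p a + eval q a
  eval (p ⊗ q)  a = eval p a * eval q a
  eval (⊝ p)    a = - eval p a

  IsSolution : ∀ {m n} → (Fin m → Poly n) → (Fin n → Carrier) → Set ℓ
  IsSolution ps a = ∀ k → eval (ps k) a ≈ 0#

  Infinite : ∀ {s} → Pred Carrier s → Set (c ⊔ ℓ ⊔ s)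
  Infinite S = ¬ (Σ (List Carrier) λ xs → ∀ x → x ∈ S → Any (x ≈_) xs)

  -- A partition of S into r cells C₀,…,C_{r-1}, given as a colouring
  -- χ (the cell of x ∈ S is χ x); it must respect the ring's equality.
  Colouring : ℕ → Set (c ⊔ ℓ)
  Colouring r = Σ (Carrier → Fin r) λ χ → ∀ {x y} → x ≈ y → χ x ≡ χ y

  MonoIn : ∀ {s n r} → Pred Carrier s → (Carrier → Fin r) → Fin r → (Fin n → Carrier) → Set s
  MonoIn S χ i a = ∀ j → (a j ∈ S) × (χ (a j) ≡ i)

  PairwiseDistinct : ∀ {n} → (Fin n → Carrier) → Set ℓ
  PairwiseDistinct a = ∀ i j → i ≢ j → ¬ (a i ≈ a j)

  PartitionRegular : ∀ {s m n} → Pred Carrier s → (Fin m → Poly n) → Set (c ⊔ ℓ ⊔ s)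
  PartitionRegular S ps = ∀ r → (χ : Colouring r) →
    Σ (Fin r) λ i → Σ (Fin _ → Carrier) λ a →
      MonoIn S (Σ.proj₁ χ) i a × IsSolution ps a

  InjectivelyPartitionRegular : ∀ {s m n} → Pred Carrier s → (Fin m → Poly n) → Set (c ⊔ ℓ ⊔ s)
  InjectivelyPartitionRegular S ps = ∀ r → (χ : Colouring r) →
    Σ (Fin r) λ i → Σ (Fin _ → Carrier) λ a →
      MonoIn S (Σ.proj₁ χ) i a × IsSolution ps a × PairwiseDistinct a

  HasConstantSolution : ∀ {s m n} → Pred Carrier s → (Fin m → Poly n) → Set (c ⊔ ℓ ⊔ s)
  HasConstantSolution S ps = Σ Carrier λ x → (x ∈ S) × IsSolution ps (λ _ → x)

{-# OPTIONS --safe #-}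
module Submission where

-- Call a colour class rich if, for every finite set, it contains a solution with
-- entries in S avoiding that set.  Some class must be rich: otherwise pick, for every
-- class i, a finite set F i witnessing that it is not, and refine the colouring so
-- that each element of B = ⋃ F i forms a class of its own.  A monochromatic solution
-- for the refinement is then either constant (excluded by hypothesis) or disjoint
-- from B, in which case it lies in some class i and avoids F i.  Inside a rich class,
-- choosing each new tuple to avoid all entries of the previous ones yields the
-- sequence.
--
-- Excluded middle decides equality and produces the witnesses F i.

open import Defs
open import Level using (Level; _⊔_; Lift; lift; lower)
open import Algebra.Bundles using (CommutativeRing)
open import Axiom.ExcludedMiddle using (ExcludedMiddle)
open import Axiom.DoubleNegationElimination using (DoubleNegationElimination; em⇒dne)
open import Data.Nat using (ℕ; zero; suc; _<_; _*_; _≤′_; ≤′-refl; ≤′-step)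
open import Data.Nat.Properties using (≤⇒≤′)
open import Data.Fin using (Fin; combine) renaming (zero to fzero; suc to fsuc)
open import Data.Fin.Properties using (combine-injective)
open import Data.List using (List; []; _∷_; _++_; concat; tabulate)
open import Data.List.Relation.Unary.Any using (here; there; any?)
import Data.List.Relation.Unary.Any as Any
open import Data.List.Relation.Unary.Any.Properties using (++⁺ˡ; ++⁺ʳ; concat⁺; tabulate⁺)
open import Data.Product using (Σ; _×_; proj₁; proj₂; _,_)
open import Data.Empty using (⊥-elim)
open import Data.Sum using (_⊎_; inj₁; inj₂)
open import Function using (id; case_of_)
open import Relation.Nullary using (¬_; Dec; yes; no; contradiction)
open import Relation.Nullary.Decidable using (map′)
open import Relation.Unary using (Pred; _∈_)
import Relation.Unary as U
open import Relation.Binary.Definitions using (Decidable; _Respects_)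
open import Relation.Binary.PropositionalEquality using (_≡_; cong₂)
  renaming (refl to ≡-refl; sym to ≡-sym; trans to ≡-trans)

private
  side : ∀ {a} {A : Set a} → Dec A → Fin 2
  side (yes _) = fzero
  side (no _)  = fsuc fzero

module _ {c ℓ} (R : CommutativeRing c ℓ) where
  open CommutativeRing R using (Carrier; _≈_; refl; sym; trans; setoid; +-cong; *-cong; -‿cong)
  open import Data.List.Membership.Setoid setoid using () renaming (_∈_ to _∈ₗ_; _∉_ to _∉ₗ_)

  private variable
    p q s g : Level
    m n L r r′ : ℕ

  eval-cong : (P : Poly R n) {a b : Fin n → Carrier} → (∀ j → a j ≈ b j) → eval R P a ≈ eval R P b
  eval-cong (con x) a≈b = refl
  eval-cong (var j) a≈b = a≈b j
  eval-cong (P ⊕ Q) a≈b = +-cong (eval-cong P a≈b) (eval-cong Q a≈b)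
  eval-cong (P ⊗ Q) a≈b = *-cong (eval-cong P a≈b) (eval-cong Q a≈b)
  eval-cong (⊝ P)   a≈b = -‿cong (eval-cong P a≈b)

  IsSolution-resp : {ps : Fin m → Poly R n} {a b : Fin n → Carrier} →
    (∀ j → a j ≈ b j) → IsSolution R ps a → IsSolution R ps b
  IsSolution-resp {ps = ps} a≈b sol k = trans (sym (eval-cong (ps k) a≈b)) (sol k)

  colour : Colouring R r → Carrier → Fin r
  colour = proj₁

  _Refines_ : Colouring R r → Colouring R r′ → Set c
  κ Refines χ = ∀ {x y} → colour κ x ≡ colour κ y → colour χ x ≡ colour χ y

  Separates : Colouring R r → List Carrier → Set (c ⊔ ℓ)
  Separates κ F = ∀ {x y} → colour κ x ≡ colour κ y → x ∈ₗ F → y ≈ x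

  _×ᶜ_ : Colouring R r → Colouring R r′ → Colouring R (r * r′)
  κ ×ᶜ κ′ = (λ x → combine (colour κ x) (colour κ′ x))
          , λ x≈y → cong₂ combine (proj₂ κ x≈y) (proj₂ κ′ x≈y)

  ×ᶜ-injective : (κ : Colouring R r) (κ′ : Colouring R r′) {x y : Carrier} →
    colour (κ ×ᶜ κ′) x ≡ colour (κ ×ᶜ κ′) y → colour κ x ≡ colour κ y × colour κ′ x ≡ colour κ′ y
  ×ᶜ-injective κ κ′ {x} {y} = combine-injective (colour κ x) (colour κ′ x) (colour κ y) (colour κ′ y)

  module _ {P : Pred Carrier p} (P? : U.Decidable P) (P-resp : P Respects _≈_) where

    indicator : Colouring R 2
    indicator = (λ x → side (P? x)) , side-resp
      where
      side-resp : ∀ {x y} → x ≈ y → side (P? x) ≡ side (P? y)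
      side-resp {x} {y} x≈y with P? x | P? y
      ... | yes _  | yes _  = ≡-refl
      ... | no _   | no _   = ≡-refl
      ... | yes Px | no ¬Py = contradiction (P-resp x≈y Px) ¬Py
      ... | no ¬Px | yes Py = contradiction (P-resp (sym x≈y) Py) ¬Px

    indicator-separates : ∀ {x y} → colour indicator x ≡ colour indicator y → P x → P y
    indicator-separates {x} {y} with P? x | P? y
    ... | _      | yes Py = λ _ _ → Py
    ... | yes _  | no _   = λ ()
    ... | no ¬Px | no _   = λ _ Px → contradiction Px ¬Px

  record SeparatingRefinement (χ : Colouring R L) (F : List Carrier) : Set (c ⊔ ℓ) where
    field
      {size}    : ℕ
      colouring : Colouring R size
      refines   : colouring Refines χ
      separates : Separates colouring F

  separatingRefinement : Decidable _≈_ → (χ : Colouring R L) (F : List Carrier) →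
    SeparatingRefinement χ F
  separatingRefinement _≈?_ χ [] = record { colouring = χ ; refines = id ; separates = λ _ () }
  separatingRefinement _≈?_ χ (z ∷ F) = record
    { colouring = ≈z ×ᶜ colouring
    ; refines   = λ same → refines (proj₂ (×ᶜ-injective ≈z colouring same))
    ; separates = separates′
    }
    where
    open SeparatingRefinement (separatingRefinement _≈?_ χ F)
    ≈z-resp : (_≈ z) Respects _≈_
    ≈z-resp x≈y x≈z = trans (sym x≈y) x≈z
    ≈z : Colouring R 2
    ≈z = indicator (_≈? z) ≈z-resp
    separates′ : Separates (≈z ×ᶜ colouring) (z ∷ F)
    separates′ {y = y} same (here x≈z) = trans y≈z (sym x≈z)
      where
      y≈z : y ≈ z
      y≈z = indicator-separates (_≈? z) ≈z-resp (proj₁ (×ᶜ-injective ≈z colouring same)) x≈z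
    separates′ same (there x∈F) = separates (proj₂ (×ᶜ-injective ≈z colouring same)) x∈F

  Avoids : List Carrier → (Fin n → Carrier) → Set (c ⊔ ℓ)
  Avoids F a = ∀ j → a j ∉ₗ F

  constant-or-avoids : Decidable _≈_ → (κ : Colouring R r) {B : List Carrier} → Separates κ B →
    {a : Fin n → Carrier} (j₀ : Fin n) → (∀ j → colour κ (a j) ≡ colour κ (a j₀)) →
    (∀ j → a j ≈ a j₀) ⊎ Avoids B a
  constant-or-avoids _≈?_ κ {B} sep {a} j₀ same with any? (a j₀ ≈?_) B
  ... | yes a₀∈B = inj₁ λ j → sep (≡-sym (same j)) a₀∈B
  ... | no a₀∉B  = inj₂ λ j aj∈B → a₀∉B (Any.map (trans (sep (same j) aj∈B)) aj∈B)

  PartitionRegularFor : Pred Carrier s → Pred (Fin n → Carrier) g → Set (c ⊔ ℓ ⊔ s ⊔ g)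
  PartitionRegularFor S Good = ∀ r (κ : Colouring R r) →
    Σ (Fin r) λ i → Σ (Fin _ → Carrier) λ a → MonoIn R S (colour κ) i a × Good a

  PartitionRegularFor-map : {S : Pred Carrier s} {G : Pred (Fin n → Carrier) g}
    {G′ : Pred (Fin n → Carrier) q} →
    (∀ {a} → G a → G′ a) → PartitionRegularFor S G → PartitionRegularFor S G′
  PartitionRegularFor-map G⇒G′ reg r κ with reg r κ
  ... | i , a , mono , good = i , a , mono , G⇒G′ good

  NoConstantIn : Pred Carrier s → Pred (Fin n → Carrier) g → Set (c ⊔ ℓ ⊔ s ⊔ g)
  NoConstantIn S Good = ∀ {a x} → x ∈ S → (∀ j → a j ≈ x) → ¬ Good a

  Fresh : Pred Carrier s → Pred (Fin n → Carrier) g → Colouring R L → Fin L → List Carrier →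
    Set (c ⊔ ℓ ⊔ s ⊔ g)
  Fresh S Good χ i F = Σ (Fin _ → Carrier) λ a → (MonoIn R S (colour χ) i a × Good a) × Avoids F a

  RichCell : Pred Carrier s → Pred (Fin n → Carrier) g → Colouring R L → Fin L → Set (c ⊔ ℓ ⊔ s ⊔ g)
  RichCell S Good χ i = ∀ F → Fresh S Good χ i F

  fresh-in-some-cell : {S : Pred Carrier s} {Good : Pred (Fin (suc n) → Carrier) g} →
    Decidable _≈_ → PartitionRegularFor S Good → NoConstantIn S Good →
    (χ : Colouring R L) (F : Fin L → List Carrier) → Σ (Fin L) λ i → Fresh S Good χ i (F i)
  fresh-in-some-cell {S = S} {Good} _≈?_ reg noConstant χ F = fresh (reg size colouring)
    where
    B : List Carrier
    B = concat (tabulate F)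
    open SeparatingRefinement (separatingRefinement _≈?_ χ B)
    fresh : (Σ (Fin size) λ i → Σ (Fin _ → Carrier) λ a → MonoIn R S (colour colouring) i a × Good a) →
            Σ (Fin _) λ i → Fresh S Good χ i (F i)
    fresh (_ , a , mono , good) =
      case constant-or-avoids _≈?_ colouring separates fzero same of λ where
        (inj₁ constant) → contradiction good (noConstant (proj₁ (mono fzero)) constant)
        (inj₂ avoidsB)  → colour χ (a fzero) , a
                        , ((λ j → proj₁ (mono j) , refines (same j)) , good)
                        , λ j aj∈F → avoidsB j (concat⁺ (tabulate⁺ {f = F} _ aj∈F))
      where
      same : ∀ j → colour colouring (a j) ≡ colour colouring (a fzero)
      same j = ≡-trans (proj₂ (mono j)) (≡-sym (proj₂ (mono fzero)))

  ∃-richCell : {S : Pred Carrier s} {Good : Pred (Fin (suc n) → Carrier) g} →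
    ExcludedMiddle (c ⊔ ℓ ⊔ s ⊔ g) → PartitionRegularFor S Good → NoConstantIn S Good →
    (χ : Colouring R L) → Σ (Fin L) (RichCell S Good χ)
  ∃-richCell {s = s} {g = g} {L = L} {S = S} {Good} em reg noConstant χ = dne λ noRichCell →
    let i , fresh = fresh-in-some-cell _≈?_ reg noConstant χ (λ i → proj₁ (obstruction noRichCell i))
    in proj₂ (obstruction noRichCell i) fresh
    where
    dne : DoubleNegationElimination (c ⊔ ℓ ⊔ s ⊔ g)
    dne = em⇒dne em
    _≈?_ : Decidable _≈_
    x ≈? y = map′ lower lift (em {Lift (c ⊔ s ⊔ g) (x ≈ y)})
    obstruction : ¬ Σ (Fin L) (RichCell S Good χ) → ∀ i → Σ (List Carrier) λ F → ¬ Fresh S Good χ i F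
    obstruction noRichCell i = dne λ noObstruction →
      noRichCell (i , λ F → dne λ notFresh → noObstruction (F , notFresh))

  freshSequence : {Q : Pred (Fin n → Carrier) q} →
    (∀ F → Σ (Fin n → Carrier) λ a → Q a × Avoids F a) →
    Σ (ℕ → Fin n → Carrier) λ a → (∀ t → Q (a t)) × (∀ t₁ t₂ i j → t₁ < t₂ → ¬ (a t₁ i ≈ a t₂ j))
  freshSequence {n = n} fresh = a , (λ t → proj₁ (proj₂ (fresh (used t)))) , separated
    where
    used : ℕ → List Carrier
    a : ℕ → Fin n → Carrier
    a t = proj₁ (fresh (used t))
    used zero    = []
    used (suc t) = used t ++ tabulate (a t)
    used-mono : ∀ {t t′ x} → t ≤′ t′ → x ∈ₗ used t → x ∈ₗ used t′
    used-mono ≤′-refl        x∈ = x∈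
    used-mono (≤′-step t≤t′) x∈ = ++⁺ˡ (used-mono t≤t′ x∈)
    separated : ∀ t₁ t₂ i j → t₁ < t₂ → ¬ (a t₁ i ≈ a t₂ j)
    separated t₁ t₂ i j t₁<t₂ e = proj₂ (proj₂ (fresh (used t₂))) j
      (used-mono (≤⇒≤′ t₁<t₂) (++⁺ʳ (used t₁) (tabulate⁺ i (sym e))))

  Admissible : Pred Carrier s → (Fin m → Poly R n) → Pred (Fin n → Carrier) (c ⊔ ℓ ⊔ s)
  Admissible S ps a = IsSolution R ps a × (InjectivelyPartitionRegular R S ps → PairwiseDistinct R a)

  admissible-regular : (S : Pred Carrier s) (ps : Fin m → Poly R n) → ExcludedMiddle (c ⊔ ℓ ⊔ s) →
    PartitionRegular R S ps → PartitionRegularFor S (Admissible S ps)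
  admissible-regular S ps em pr with em {InjectivelyPartitionRegular R S ps}
  ... | yes ipr = PartitionRegularFor-map {S = S} (λ (sol , distinct) → sol , λ _ → distinct) ipr
  ... | no ¬ipr = PartitionRegularFor-map {S = S} (λ sol → sol , λ ipr → contradiction ipr ¬ipr) pr

  admissible-noConstant : (S : Pred Carrier s) (ps : Fin m → Poly R n) →
    ¬ HasConstantSolution R S ps → NoConstantIn S (Admissible S ps)
  admissible-noConstant S ps noConstant x∈S a≈x (sol , _) =
    noConstant (_ , x∈S , IsSolution-resp {ps = ps} a≈x sol)

lemma2p17 : ∀ {c ℓ s} → ExcludedMiddle (c ⊔ ℓ ⊔ s) →
    (R : CommutativeRing c ℓ) → IsIntegralDomain R →
    let open CommutativeRing R in
    (S : Pred Carrier s) → Infinite R S →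
    (m n : ℕ) (ps : Fin m → Poly R n) →
    PartitionRegular R S ps → ¬ HasConstantSolution R S ps →
    (L : ℕ) (χ : Colouring R L) →
    Σ (Fin L) λ i₀ → Σ (ℕ → Fin n → Carrier) λ a →
      (∀ t → MonoIn R S (proj₁ χ) i₀ (a t)) ×
      (∀ t → IsSolution R ps (a t)) ×
      (∀ t₁ t₂ i j → t₁ < t₂ → ¬ (a t₁ i ≈ a t₂ j)) ×
      (InjectivelyPartitionRegular R S ps → ∀ t → PairwiseDistinct R (a t))
lemma2p17 em R _ S infinite m zero ps pr noConstant L χ with pr 1 ((λ _ → fzero) , λ _ → ≡-refl)
... | _ , _ , _ , solution =
  -- a solution in zero variables is a constant solution for every x, so S must be empty
  ⊥-elim (infinite ([] , λ x x∈S →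
    contradiction (x , x∈S , IsSolution-resp R {ps = ps} (λ ()) solution) noConstant))
lemma2p17 em R _ S infinite m (suc n) ps pr noConstant L χ =
  let i , rich = ∃-richCell R em (admissible-regular R S ps em pr)
                             (admissible-noConstant R S ps noConstant) χ
      a , good , separated = freshSequence R rich
  in i , a , (λ t → proj₁ (good t)) , (λ t → proj₁ (proj₂ (good t))) , separated
   , λ ipr t → proj₂ (proj₂ (good t)) ipr
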